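{- Let $x_0$ be a real number such that for every $x>x_0$ the interval $[x-x^{0.525},x]$ contains a prime, and let $r$ be the index with $p_{r-1}\le x_0<p_r$. Then for every integer $n>p_r$ there is a prime number $p$ with $(n-1)^2<p^{1-\epsilon}<n^2$, where $\epsilon=0.05$.
   Context: $p_1=2,p_2=3,\dots$ denotes the sequence of primes in increasing order. A constant $x_0$ as in the claim exists (Baker–Harman–Pintz).
   Formalization: The constant $x_0$ is rational rather than real, and the points $x$ at which $[x-x^{0.525},x]$ must contain a prime are taken in ℚ. -}

module Defs where

open import Data.Nat using (ℕ; zero; suc)
open import Data.Integer using (+_)
open import Data.List using (upTo; filter; length)
open import Data.Nat.Primality using (Prime; prime?)
open import Data.Product using (_×_)
open import Relation.Binary.PropositionalEquality using (_≡_)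
open import Data.Rational using (ℚ; _/_; _*_; 1ℚ)

toℚ : ℕ → ℚ
toℚ n = (+ n) / 1

_^ℚ_ : ℚ → ℕ → ℚ
q ^ℚ zero = 1ℚ
q ^ℚ suc k = q * (q ^ℚ k)

infixr 8 _^ℚ_

primeCount : ℕ → ℕ
primeCount m = length (filter prime? (upTo (suc m)))

-- NthPrime r P : P is the r-th prime p_r (1-indexed: p_1 = 2, p_2 = 3, …)
NthPrime : ℕ → ℕ → Set
NthPrime r P = Prime P × primeCount P ≡ r

-- Write m = n ∸ 1.  Choose b with b ≥ 76 n¹⁸ and let a be the integer part of b n^(1/19), so that
-- n − 1/4 ≤ (a/b)¹⁹ < n (the 19th powers of a and a + 1 differ by at most b¹⁹/4).  Apply the
-- hypothesis to x = (a/b)⁴⁰ ≥ m > x₀: since x^(21/40) = (a/b)²¹ is rational, everything can be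
-- cleared of denominators.  The prime p ≤ x < n^(40/19) gives the upper bound, and
-- p ≥ x − (a/b)²¹ = (a/b)²¹((a/b)¹⁹ − 1) ≥ (m + 3/4)^(21/19) (m − 1/4) > m^(40/19) the lower one,
-- the last step being (m + 3/4)(m − 1/4) ≥ m².
module Submission where

module PowerBounds where

  open import Data.Nat
  open import Data.Nat.Properties
  open import Data.Nat.Tactic.RingSolver using (solve-∀)
  open import Data.Product using (_×_; _,_; ∃-syntax)
  open import Data.Empty using (⊥-elim)
  open import Relation.Binary.PropositionalEquality
  open import Relation.Nullary using (yes; no)

  ^-distribʳ-* : ∀ m n k → (m * n) ^ k ≡ m ^ k * n ^ k
  ^-distribʳ-* m n zero    = refl
  ^-distribʳ-* m n (suc k) = begin
    m * n * (m * n) ^ k      ≡⟨ cong (m * n *_) (^-distribʳ-* m n k) ⟩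
    m * n * (m ^ k * n ^ k)  ≡⟨ interchange m n (m ^ k) (n ^ k) ⟩
    m * m ^ k * (n * n ^ k)  ∎
    where
    open ≡-Reasoning
    interchange : ∀ a b c d → a * b * (c * d) ≡ a * c * (b * d)
    interchange = solve-∀

  ^-^-comm : ∀ x i j → (x ^ i) ^ j ≡ (x ^ j) ^ i
  ^-^-comm x i j = trans (^-*-assoc x i j) (trans (cong (x ^_) (*-comm i j)) (sym (^-*-assoc x j i)))

  ^-cancelˡ-< : ∀ k {u v} → u ^ k < v ^ k → u < v
  ^-cancelˡ-< k {u} {v} uᵏ<vᵏ with u <? v
  ... | yes u<v = u<v
  ... | no  u≮v = ⊥-elim (<⇒≱ uᵏ<vᵏ (^-monoˡ-≤ k (≮⇒≥ u≮v)))

  ^-cancelˡ-≤ : ∀ k .{{_ : NonZero k}} {u v} → u ^ k ≤ v ^ k → u ≤ v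
  ^-cancelˡ-≤ k {u} {v} uᵏ≤vᵏ with u ≤? v
  ... | yes u≤v = u≤v
  ... | no  u≰v = ⊥-elim (<⇒≱ (^-monoˡ-< k (≰⇒> u≰v)) uᵏ≤vᵏ)

  ^-mean-value-≤ : ∀ u k → suc u ^ suc k ≤ u ^ suc k + suc k * suc u ^ k
  ^-mean-value-≤ u zero    = ≤-reflexive (base u)
    where
    base : ∀ u → suc u * 1 ≡ u * 1 + 1 * 1
    base = solve-∀
  ^-mean-value-≤ u (suc k) = begin
    suc u * suc u ^ suc k                       ≤⟨ *-monoʳ-≤ (suc u) (^-mean-value-≤ u k) ⟩
    suc u * (x + suc k * y)                     ≡⟨ expand u x k y ⟩
    u * x + x + suc k * (suc u * y)             ≤⟨ +-monoˡ-≤ (suc k * (suc u * y)) (+-monoʳ-≤ (u * x) x≤suc-u*y) ⟩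
    u * x + suc u * y + suc k * (suc u * y)     ≡⟨ collect u x k y ⟩
    u * x + suc (suc k) * (suc u * y)           ∎
    where
    open ≤-Reasoning
    x : ℕ
    x = u ^ suc k
    y : ℕ
    y = suc u ^ k
    x≤suc-u*y : x ≤ suc u * y
    x≤suc-u*y = ^-monoˡ-≤ (suc k) (n≤1+n u)
    expand : ∀ u x k y → suc u * (x + suc k * y) ≡ u * x + x + suc k * (suc u * y)
    expand = solve-∀
    collect : ∀ u x k y → u * x + suc u * y + suc k * (suc u * y) ≡ u * x + suc (suc k) * (suc u * y)
    collect = solve-∀

  root-bracket : ∀ k Y .{{_ : NonZero Y}} → ∃[ a ] (a ^ suc k < Y × Y ≤ suc a ^ suc k)
  root-bracket k Y = search Y (m≤m*n Y (Y ^ k) {{m^n≢0 Y k}})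
    where
    search : ∀ c → Y ≤ c ^ suc k → ∃[ a ] (a ^ suc k < Y × Y ≤ suc a ^ suc k)
    search zero    Y≤0 = ⊥-elim (<⇒≱ (>-nonZero⁻¹ Y) Y≤0)
    search (suc c) Y≤[1+c]ᵏ with Y ≤? c ^ suc k
    ... | yes Y≤cᵏ = search c Y≤cᵏ
    ... | no  Y≰cᵏ = c , ≰⇒> Y≰cᵏ , Y≤[1+c]ᵏ

  root-bracket-tight : ∀ c e n b a .{{_ : NonZero n}} → c * suc e * n ^ e ≤ b →
                       a ^ suc e < n * b ^ suc e → n * b ^ suc e ≤ suc a ^ suc e →
                       c * (n * b ^ suc e) ≤ c * a ^ suc e + b ^ suc e
  root-bracket-tight c e n b a b-large below above = begin
    c * (n * b ^ suc e)                        ≤⟨ *-monoʳ-≤ c above ⟩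
    c * suc a ^ suc e                          ≤⟨ *-monoʳ-≤ c (^-mean-value-≤ a e) ⟩
    c * (a ^ suc e + suc e * suc a ^ e)        ≤⟨ *-monoʳ-≤ c (+-monoʳ-≤ (a ^ suc e) (*-monoʳ-≤ (suc e) (^-monoˡ-≤ e a<nb))) ⟩
    c * (a ^ suc e + suc e * (n * b) ^ e)      ≡⟨ cong (λ z → c * (a ^ suc e + suc e * z)) (^-distribʳ-* n b e) ⟩
    c * (a ^ suc e + suc e * (n ^ e * b ^ e))  ≡⟨ regroup c (a ^ suc e) e (n ^ e) (b ^ e) ⟩
    c * a ^ suc e + c * suc e * n ^ e * b ^ e  ≤⟨ +-monoʳ-≤ (c * a ^ suc e) (*-monoˡ-≤ (b ^ e) b-large) ⟩
    c * a ^ suc e + b ^ suc e                  ∎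
    where
    open ≤-Reasoning
    a<nb : a < n * b
    a<nb = ^-cancelˡ-< (suc e) (begin-strict
      a ^ suc e              <⟨ below ⟩
      n * b ^ suc e          ≤⟨ *-monoˡ-≤ (b ^ suc e) (m≤m*n n (n ^ e) {{m^n≢0 n e}}) ⟩
      n ^ suc e * b ^ suc e  ≡⟨ ^-distribʳ-* n b (suc e) ⟨
      (n * b) ^ suc e        ∎)
    regroup : ∀ c x e y z → c * (x + suc e * (y * z)) ≡ c * x + c * suc e * y * z
    regroup = solve-∀

  u*u≤v*w⇒u^[2+2j]<v^[2+j]*w^j : ∀ j {u v w} .{{_ : NonZero w}} → u * u ≤ v * w → u < v →
                                  u ^ (2 * suc j) < v ^ (2 + j) * w ^ j
  u*u≤v*w⇒u^[2+2j]<v^[2+j]*w^j j {u} {v} {w} uu≤vw u<v = begin-strict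
    u ^ (2 * suc j)          ≡⟨ ^-*-assoc u 2 (suc j) ⟨
    (u ^ 2) ^ suc j          ≡⟨ cong (λ z → (u * z) ^ suc j) (*-identityʳ u) ⟩
    u * u * (u * u) ^ j      ≤⟨ *-monoʳ-≤ (u * u) (^-monoˡ-≤ j uu≤vw) ⟩
    u * u * (v * w) ^ j      <⟨ *-monoˡ-< ((v * w) ^ j) {{m^n≢0 (v * w) j {{m*n≢0 v w}}}} (*-mono-< u<v u<v) ⟩
    v * v * (v * w) ^ j      ≡⟨ cong (v * v *_) (^-distribʳ-* v w j) ⟩
    v * v * (v ^ j * w ^ j)  ≡⟨ reassoc v (v ^ j) (w ^ j) ⟩
    v ^ (2 + j) * w ^ j      ∎
    where
    open ≤-Reasoning
    instance
      v≢0 : NonZero v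
      v≢0 = >-nonZero (m<n⇒0<n u<v)
    reassoc : ∀ v x y → v * v * (x * y) ≡ v * (v * x) * y
    reassoc = solve-∀

  -- From here on m = suc k, so 7 + 4 * k = 4m + 3 and 3 + 4 * k = 4m − 1.  Implicit arguments
  -- are given explicitly, and 76 is written 4 * 19, wherever Agda would otherwise unfold a
  -- power to compare two terms.

  [4m+3]B≤4A⇒mB<A : ∀ k {A B} .{{_ : NonZero B}} → (7 + 4 * k) * B ≤ 4 * A → suc k * B < A
  [4m+3]B≤4A⇒mB<A k {A} {B} hA = *-cancelˡ-< 4 _ _ (begin-strict
    4 * (suc k * B)  ≡⟨ quadruple k B ⟩
    (4 + 4 * k) * B  <⟨ *-monoˡ-< B (m<n+m (4 + 4 * k) {3} z<s) ⟩
    (7 + 4 * k) * B  ≤⟨ hA ⟩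
    4 * A            ∎)
    where
    open ≤-Reasoning
    quadruple : ∀ k B → 4 * (suc k * B) ≡ (4 + 4 * k) * B
    quadruple = solve-∀

  [4m+3]B≤4A⇒B≤A : ∀ k {A B} .{{_ : NonZero B}} → (7 + 4 * k) * B ≤ 4 * A → B ≤ A
  [4m+3]B≤4A⇒B≤A k {A} {B} hA = ≤-trans (m≤n*m B (suc k)) (<⇒≤ ([4m+3]B≤4A⇒mB<A k hA))

  [4m+3]B≤4[B+D]⇒m⁴⁰B⁴⁰<[B+D]²¹D¹⁹ : ∀ k {B D} .{{_ : NonZero B}} → (7 + 4 * k) * B ≤ 4 * (B + D) →
                                     suc k ^ 40 * B ^ 40 < (B + D) ^ 21 * D ^ 19
  [4m+3]B≤4[B+D]⇒m⁴⁰B⁴⁰<[B+D]²¹D¹⁹ k {B} {D} hA = begin-strict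
    suc k ^ 40 * B ^ 40    ≡⟨ ^-distribʳ-* (suc k) B 40 ⟨
    (suc k * B) ^ 40       <⟨ u*u≤v*w⇒u^[2+2j]<v^[2+j]*w^j 19 {suc k * B} {B + D} {D} {{D≢0}}
                                square ([4m+3]B≤4A⇒mB<A k hA) ⟩
    (B + D) ^ 21 * D ^ 19  ∎
    where
    open ≤-Reasoning
    hD : (3 + 4 * k) * B ≤ 4 * D
    hD = +-cancelˡ-≤ (4 * B) _ _ (begin
      4 * B + (3 + 4 * k) * B  ≡⟨ split k B ⟩
      (7 + 4 * k) * B          ≤⟨ hA ⟩
      4 * (B + D)              ≡⟨ *-distribˡ-+ 4 B D ⟩
      4 * B + 4 * D            ∎)
      where
      split : ∀ k B → 4 * B + (3 + 4 * k) * B ≡ (7 + 4 * k) * B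
      split = solve-∀
    D≢0 : NonZero D
    D≢0 = >-nonZero (*-cancelˡ-< 4 0 D (<-≤-trans 0<[3+4k]B hD))
      where
      0<[3+4k]B : 0 < (3 + 4 * k) * B
      0<[3+4k]B = >-nonZero⁻¹ ((3 + 4 * k) * B) {{m*n≢0 (3 + 4 * k) B}}
    square : suc k * B * (suc k * B) ≤ (B + D) * D
    square = *-cancelˡ-≤ 16 (begin
      16 * (suc k * B * (suc k * B))                           ≡⟨ lhs k B ⟩
      (4 + 4 * k) * B * ((4 + 4 * k) * B)                      ≤⟨ m≤m+n _ _ ⟩
      (4 + 4 * k) * B * ((4 + 4 * k) * B) + (5 + 8 * k) * B * B ≡⟨ gap k B ⟩
      (7 + 4 * k) * B * ((3 + 4 * k) * B)                      ≤⟨ *-mono-≤ hA hD ⟩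
      4 * (B + D) * (4 * D)                                    ≡⟨ rhs (B + D) D ⟩
      16 * ((B + D) * D)                                       ∎)
      where
      lhs : ∀ k B → 16 * (suc k * B * (suc k * B)) ≡ (4 + 4 * k) * B * ((4 + 4 * k) * B)
      lhs = solve-∀
      gap : ∀ k B → (4 + 4 * k) * B * ((4 + 4 * k) * B) + (5 + 8 * k) * B * B
                  ≡ (7 + 4 * k) * B * ((3 + 4 * k) * B)
      gap = solve-∀
      rhs : ∀ A D → 4 * A * (4 * D) ≡ 16 * (A * D)
      rhs = solve-∀

  root-approx : ∀ k b .{{_ : NonZero b}} → 4 * 19 * suc (suc k) ^ 18 ≤ b →
                ∃[ a ] (a ^ 19 < suc (suc k) * b ^ 19 × (7 + 4 * k) * b ^ 19 ≤ 4 * a ^ 19)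
  root-approx k b b-large =
    tighten (root-bracket 18 (suc (suc k) * b ^ 19) {{m*n≢0 (suc (suc k)) (b ^ 19) {{_}} {{m^n≢0 b 19}}}})
    where
    tighten : ∃[ a ] (a ^ 19 < suc (suc k) * b ^ 19 × suc (suc k) * b ^ 19 ≤ suc a ^ 19) →
              ∃[ a ] (a ^ 19 < suc (suc k) * b ^ 19 × (7 + 4 * k) * b ^ 19 ≤ 4 * a ^ 19)
    tighten (a , below , above) = a , below , +-cancelʳ-≤ (b ^ 19) _ _ (begin
      (7 + 4 * k) * b ^ 19 + b ^ 19  ≡⟨ regroup k (b ^ 19) ⟩
      4 * (suc (suc k) * b ^ 19)     ≤⟨ root-bracket-tight 4 18 (suc (suc k)) b a b-large below above ⟩
      4 * a ^ 19 + b ^ 19            ∎)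
      where
      open ≤-Reasoning
      regroup : ∀ k B → (7 + 4 * k) * B + B ≡ 4 * (suc (suc k) * B)
      regroup = solve-∀

  [4m+3]B≤4A⇒m*b⁴⁰≤a⁴⁰ : ∀ k a b .{{_ : NonZero b}} → (7 + 4 * k) * b ^ 19 ≤ 4 * a ^ 19 →
                         suc k * b ^ 40 ≤ a ^ 40
  [4m+3]B≤4A⇒m*b⁴⁰≤a⁴⁰ k a b hA = begin
    suc k * b ^ 40             ≡⟨ cong (suc k *_) (^-distribˡ-+-* b 19 21) ⟩
    suc k * (b ^ 19 * b ^ 21)  ≡⟨ *-assoc (suc k) (b ^ 19) (b ^ 21) ⟨
    suc k * b ^ 19 * b ^ 21    ≤⟨ *-mono-≤ (<⇒≤ mB<A) (^-monoˡ-≤ 21 b≤a) ⟩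
    a ^ 19 * a ^ 21            ≡⟨ ^-distribˡ-+-* a 19 21 ⟨
    a ^ 40                     ∎
    where
    open ≤-Reasoning
    B≢0 : NonZero (b ^ 19)
    B≢0 = m^n≢0 b 19
    mB<A : suc k * b ^ 19 < a ^ 19
    mB<A = [4m+3]B≤4A⇒mB<A k {a ^ 19} {b ^ 19} {{B≢0}} hA
    b≤a : b ≤ a
    b≤a = ^-cancelˡ-≤ 19 ([4m+3]B≤4A⇒B≤A k {a ^ 19} {b ^ 19} {{B≢0}} hA)

  prime-window-upper : ∀ n a b p → a ^ 19 < n * b ^ 19 → p * b ^ 40 ≤ a ^ 40 → p ^ 19 < n ^ 40
  prime-window-upper n a b p below p-below = *-cancelʳ-< ((b ^ 19) ^ 40) _ _ (begin-strict
    p ^ 19 * (b ^ 19) ^ 40   ≡⟨ cong (p ^ 19 *_) (^-^-comm b 40 19) ⟨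
    p ^ 19 * (b ^ 40) ^ 19   ≡⟨ ^-distribʳ-* p (b ^ 40) 19 ⟨
    (p * b ^ 40) ^ 19        ≤⟨ ^-monoˡ-≤ 19 p-below ⟩
    (a ^ 40) ^ 19            ≡⟨ ^-^-comm a 40 19 ⟩
    (a ^ 19) ^ 40            <⟨ ^-monoˡ-< 40 below ⟩
    (n * b ^ 19) ^ 40        ≡⟨ ^-distribʳ-* n (b ^ 19) 40 ⟩
    n ^ 40 * (b ^ 19) ^ 40   ∎)
    where open ≤-Reasoning

  prime-window-lower : ∀ k a b p .{{_ : NonZero b}} → (7 + 4 * k) * b ^ 19 ≤ 4 * a ^ 19 →
                       a ^ 40 ≤ a ^ 21 * b ^ 19 + p * b ^ 40 → suc k ^ 40 < p ^ 19
  prime-window-lower k a b p hA p-above = *-cancelʳ-< (B ^ 40) (suc k ^ 40) (p ^ 19) (begin-strict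
    suc k ^ 40 * B ^ 40     <⟨ [4m+3]B≤4[B+D]⇒m⁴⁰B⁴⁰<[B+D]²¹D¹⁹ k {B} {D} hB+D ⟩
    (B + D) ^ 21 * D ^ 19   ≡⟨ cong (λ A → A ^ 21 * D ^ 19) B+D≡A ⟩
    (a ^ 19) ^ 21 * D ^ 19  ≡⟨ cong (_* D ^ 19) (^-^-comm a 19 21) ⟩
    (a ^ 21) ^ 19 * D ^ 19  ≡⟨ ^-distribʳ-* (a ^ 21) D 19 ⟨
    (a ^ 21 * D) ^ 19       ≤⟨ ^-monoˡ-≤ 19 a²¹D≤pb⁴⁰ ⟩
    (p * b ^ 40) ^ 19       ≡⟨ ^-distribʳ-* p (b ^ 40) 19 ⟩
    p ^ 19 * (b ^ 40) ^ 19  ≡⟨ cong (p ^ 19 *_) (^-^-comm b 40 19) ⟩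
    p ^ 19 * B ^ 40         ∎)
    where
    open ≤-Reasoning
    B : ℕ
    B = b ^ 19
    instance
      B≢0 : NonZero B
      B≢0 = m^n≢0 b 19
    D : ℕ
    D = a ^ 19 ∸ B
    B+D≡A : B + D ≡ a ^ 19
    B+D≡A = m+[n∸m]≡n ([4m+3]B≤4A⇒B≤A k {a ^ 19} {B} hA)
    hB+D : (7 + 4 * k) * B ≤ 4 * (B + D)
    hB+D = subst (λ A → (7 + 4 * k) * B ≤ 4 * A) (sym B+D≡A) hA
    a²¹D≤pb⁴⁰ : a ^ 21 * D ≤ p * b ^ 40
    a²¹D≤pb⁴⁰ = +-cancelˡ-≤ (a ^ 21 * B) _ _ (begin
      a ^ 21 * B + a ^ 21 * D  ≡⟨ *-distribˡ-+ (a ^ 21) B D ⟨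
      a ^ 21 * (B + D)         ≡⟨ cong (a ^ 21 *_) B+D≡A ⟩
      a ^ 21 * a ^ 19          ≡⟨ ^-distribˡ-+-* a 21 19 ⟨
      a ^ 40                   ≤⟨ p-above ⟩
      a ^ 21 * B + p * b ^ 40  ∎)

module RationalScaling where

  open import Defs
  open import Algebra.Bundles using (CommutativeRing)
  open import Data.Empty using (⊥-elim)
  open import Data.Integer as ℤ using (+_)
  import Data.Integer.Properties as ℤ
  open import Data.Nat as ℕ using (ℕ; zero; suc)
  import Data.Nat.Properties as ℕ
  open import Data.Nat.Coprimality using (1-coprimeTo) renaming (sym to coprime-sym)
  open import Data.Nat.Primality using (Prime)
  open import Data.Product using (_×_; _,_; ∃-syntax)
  open import Data.Rational
  open import Data.Rational.Properties
  open import Relation.Binary.PropositionalEquality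
  open import Relation.Nullary using (yes; no)
  open import Algebra.Properties.Group +-0-group using (//-rightDividesˡ)
  open import Algebra.Properties.CommutativeSemiring.Exp (CommutativeRing.commutativeSemiring +-*-commutativeRing)
    using (_^_; ^-distrib-*; ^-assocʳ)

  PrimesInShortIntervals : ℚ → Set
  PrimesInShortIntervals x₀ =
    ∀ (x : ℚ) → x₀ < x → ∃[ p ] (Prime p × toℚ p ≤ x × (x - toℚ p) ^ℚ 40 ≤ x ^ℚ 21)

  PrimeNear[a/b]⁴⁰ : ℕ → ℕ → Set
  PrimeNear[a/b]⁴⁰ a b =
    ∃[ p ] (Prime p × p ℕ.* b ℕ.^ 40 ℕ.≤ a ℕ.^ 40 × a ℕ.^ 40 ℕ.≤ a ℕ.^ 21 ℕ.* b ℕ.^ 19 ℕ.+ p ℕ.* b ℕ.^ 40)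

  -- toℚ n = normalize n 1 does not compute for a variable n; ι n is the same rational in
  -- normal form, on which ℚ arithmetic computes.
  private
    ι : ℕ → ℚ
    ι n = mkℚ (+ n) 0 (coprime-sym (1-coprimeTo n))

    toℚ≡ι : ∀ n → toℚ n ≡ ι n
    toℚ≡ι n = normalize-coprime (coprime-sym (1-coprimeTo n))

  toℚ-+ : ∀ m n → toℚ (m ℕ.+ n) ≡ toℚ m + toℚ n
  toℚ-+ m n rewrite toℚ≡ι m | toℚ≡ι n =
    /-cong (trans (ℤ.pos-+ m n) (sym (cong₂ ℤ._+_ (ℤ.*-identityʳ (+ m)) (ℤ.*-identityʳ (+ n))))) refl

  toℚ-* : ∀ m n → toℚ (m ℕ.* n) ≡ toℚ m * toℚ n
  toℚ-* m n rewrite toℚ≡ι m | toℚ≡ι n = /-cong (ℤ.pos-* m n) refl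

  toℚ-^ : ∀ m k → toℚ (m ℕ.^ k) ≡ toℚ m ^ℚ k
  toℚ-^ m zero    = refl
  toℚ-^ m (suc k) = trans (toℚ-* m (m ℕ.^ k)) (cong (toℚ m *_) (toℚ-^ m k))

  toℚ-mono-≤ : ∀ {m n} → m ℕ.≤ n → toℚ m ≤ toℚ n
  toℚ-mono-≤ {m} {n} m≤n rewrite toℚ≡ι m | toℚ≡ι n =
    *≤* (subst₂ ℤ._≤_ (sym (ℤ.*-identityʳ (+ m))) (sym (ℤ.*-identityʳ (+ n))) (ℤ.+≤+ m≤n))

  toℚ-cancel-≤ : ∀ {m n} → toℚ m ≤ toℚ n → m ℕ.≤ n
  toℚ-cancel-≤ {m} {n} le = ℤ.drop‿+≤+ (subst₂ ℤ._≤_ (ℤ.*-identityʳ (+ m)) (ℤ.*-identityʳ (+ n))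
    (drop-*≤* (subst₂ _≤_ (toℚ≡ι m) (toℚ≡ι n) le)))

  toℚ-nonNeg : ∀ n → NonNegative (toℚ n)
  toℚ-nonNeg n = normalize-nonNeg n 1

  toℚ-pos : ∀ n .{{_ : ℕ.NonZero n}} → Positive (toℚ n)
  toℚ-pos n = normalize-pos n 1

  ^ℚ≡^ : ∀ q k → q ^ℚ k ≡ q ^ k
  ^ℚ≡^ q zero    = refl
  ^ℚ≡^ q (suc k) = cong (q *_) (^ℚ≡^ q k)

  ^ℚ-distribʳ-* : ∀ q r k → (q * r) ^ℚ k ≡ q ^ℚ k * r ^ℚ k
  ^ℚ-distribʳ-* q r k rewrite ^ℚ≡^ (q * r) k | ^ℚ≡^ q k | ^ℚ≡^ r k = ^-distrib-* q r k

  ^ℚ-*-assoc : ∀ q j k → (q ^ℚ j) ^ℚ k ≡ q ^ℚ (j ℕ.* k)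
  ^ℚ-*-assoc q j k rewrite ^ℚ≡^ (q ^ℚ j) k | ^ℚ≡^ q j | ^ℚ≡^ q (j ℕ.* k) = ^-assocʳ q j k

  ^ℚ-nonNeg : ∀ q .{{_ : NonNegative q}} k → NonNegative (q ^ℚ k)
  ^ℚ-nonNeg q zero    = pos⇒nonNeg 1ℚ
  ^ℚ-nonNeg q (suc k) = nonNeg*nonNeg⇒nonNeg q (q ^ℚ k) {{^ℚ-nonNeg q k}}

  ^ℚ-monoˡ-< : ∀ k {u v} .{{_ : NonNegative u}} → u < v → u ^ℚ suc k < v ^ℚ suc k
  ^ℚ-monoˡ-< zero    {u} {v} u<v = subst₂ _<_ (sym (*-identityʳ u)) (sym (*-identityʳ v)) u<v
  ^ℚ-monoˡ-< (suc k) {u} {v} u<v = begin-strict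
    u * u ^ℚ suc k  ≤⟨ *-monoˡ-≤-nonNeg u (<⇒≤ uᵏ<vᵏ) ⟩
    u * v ^ℚ suc k  <⟨ *-monoˡ-<-pos (v ^ℚ suc k) {{vᵏ-pos}} u<v ⟩
    v * v ^ℚ suc k  ∎
    where
    open ≤-Reasoning
    uᵏ<vᵏ : u ^ℚ suc k < v ^ℚ suc k
    uᵏ<vᵏ = ^ℚ-monoˡ-< k u<v
    vᵏ-pos : Positive (v ^ℚ suc k)
    vᵏ-pos = positive (≤-<-trans (nonNegative⁻¹ (u ^ℚ suc k) {{^ℚ-nonNeg u (suc k)}}) uᵏ<vᵏ)

  ^ℚ-cancelˡ-≤ : ∀ k {u v} .{{_ : NonNegative v}} → u ^ℚ suc k ≤ v ^ℚ suc k → u ≤ v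
  ^ℚ-cancelˡ-≤ k {u} {v} uᵏ≤vᵏ with u ≤? v
  ... | yes u≤v = u≤v
  ... | no  u≰v = ⊥-elim (<-irrefl refl (<-≤-trans (^ℚ-monoˡ-< k (≰⇒> u≰v)) uᵏ≤vᵏ))

  prime-near-[a/b]⁴⁰ : ∀ {x₀} → PrimesInShortIntervals x₀ → ∀ a b m .{{_ : ℕ.NonZero b}} →
    x₀ < toℚ m → m ℕ.* b ℕ.^ 40 ℕ.≤ a ℕ.^ 40 → PrimeNear[a/b]⁴⁰ a b
  prime-near-[a/b]⁴⁰ gaps a b m x₀<m m≤[a/b]⁴⁰ = scale-back (gaps x (<-≤-trans x₀<m m≤x))
    where
    open ≡-Reasoning
    instance
      b-pos : Positive (toℚ b)
      b-pos = toℚ-pos b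
      b≢0 : NonZero (toℚ b)
      b≢0 = pos⇒nonZero (toℚ b)

    t : ℚ
    t = toℚ a * 1/ toℚ b

    x : ℚ
    x = t ^ℚ 40

    β : ℚ
    β = toℚ (b ℕ.^ 40)

    instance
      β-pos : Positive β
      β-pos = toℚ-pos (b ℕ.^ 40) {{ℕ.m^n≢0 b 40}}
      β-nonNeg : NonNegative β
      β-nonNeg = pos⇒nonNeg β
      t-nonNeg : NonNegative t
      t-nonNeg = nonNeg*nonNeg⇒nonNeg (toℚ a) {{toℚ-nonNeg a}} (1/ toℚ b)
                   {{pos⇒nonNeg (1/ toℚ b) {{1/pos⇒pos (toℚ b)}}}}
      t²¹-nonNeg : NonNegative (t ^ℚ 21)
      t²¹-nonNeg = ^ℚ-nonNeg t 21

    t*b≡a : t * toℚ b ≡ toℚ a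
    t*b≡a = begin
      toℚ a * 1/ toℚ b * toℚ b    ≡⟨ *-assoc (toℚ a) (1/ toℚ b) (toℚ b) ⟩
      toℚ a * (1/ toℚ b * toℚ b)  ≡⟨ cong (toℚ a *_) (*-inverseˡ (toℚ b)) ⟩
      toℚ a * 1ℚ                  ≡⟨ *-identityʳ (toℚ a) ⟩
      toℚ a                       ∎

    tᵏ*bᵏ≡aᵏ : ∀ k → t ^ℚ k * toℚ (b ℕ.^ k) ≡ toℚ (a ℕ.^ k)
    tᵏ*bᵏ≡aᵏ k = begin
      t ^ℚ k * toℚ (b ℕ.^ k)  ≡⟨ cong (t ^ℚ k *_) (toℚ-^ b k) ⟩
      t ^ℚ k * toℚ b ^ℚ k     ≡⟨ ^ℚ-distribʳ-* t (toℚ b) k ⟨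
      (t * toℚ b) ^ℚ k        ≡⟨ cong (_^ℚ k) t*b≡a ⟩
      toℚ a ^ℚ k              ≡⟨ toℚ-^ a k ⟨
      toℚ (a ℕ.^ k)           ∎

    t²¹*β≡a²¹b¹⁹ : t ^ℚ 21 * β ≡ toℚ (a ℕ.^ 21 ℕ.* b ℕ.^ 19)
    t²¹*β≡a²¹b¹⁹ = begin
      t ^ℚ 21 * β                                    ≡⟨ cong (λ c → t ^ℚ 21 * toℚ c) (ℕ.^-distribˡ-+-* b 21 19) ⟩
      t ^ℚ 21 * toℚ (b ℕ.^ 21 ℕ.* b ℕ.^ 19)          ≡⟨ cong (t ^ℚ 21 *_) (toℚ-* (b ℕ.^ 21) (b ℕ.^ 19)) ⟩
      t ^ℚ 21 * (toℚ (b ℕ.^ 21) * toℚ (b ℕ.^ 19))    ≡⟨ *-assoc (t ^ℚ 21) (toℚ (b ℕ.^ 21)) (toℚ (b ℕ.^ 19)) ⟨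
      t ^ℚ 21 * toℚ (b ℕ.^ 21) * toℚ (b ℕ.^ 19)      ≡⟨ cong (_* toℚ (b ℕ.^ 19)) (tᵏ*bᵏ≡aᵏ 21) ⟩
      toℚ (a ℕ.^ 21) * toℚ (b ℕ.^ 19)                ≡⟨ toℚ-* (a ℕ.^ 21) (b ℕ.^ 19) ⟨
      toℚ (a ℕ.^ 21 ℕ.* b ℕ.^ 19)                    ∎

    m≤x : toℚ m ≤ x
    m≤x = *-cancelʳ-≤-pos β
      (subst₂ _≤_ (toℚ-* m (b ℕ.^ 40)) (sym (tᵏ*bᵏ≡aᵏ 40)) (toℚ-mono-≤ m≤[a/b]⁴⁰))

    x≤t²¹+q : ∀ q → (x - q) ^ℚ 40 ≤ x ^ℚ 21 → x ≤ t ^ℚ 21 + q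
    x≤t²¹+q q gap = subst (_≤ t ^ℚ 21 + q) (//-rightDividesˡ q x) (+-monoˡ-≤ q x-q≤t²¹)
      where
      x²¹≡[t²¹]⁴⁰ : x ^ℚ 21 ≡ (t ^ℚ 21) ^ℚ 40
      x²¹≡[t²¹]⁴⁰ = trans (^ℚ-*-assoc t 40 21) (sym (^ℚ-*-assoc t 21 40))
      x-q≤t²¹ : x - q ≤ t ^ℚ 21
      x-q≤t²¹ = ^ℚ-cancelˡ-≤ 39 (subst ((x - q) ^ℚ 40 ≤_) x²¹≡[t²¹]⁴⁰ gap)

    scale-back : ∃[ p ] (Prime p × toℚ p ≤ x × (x - toℚ p) ^ℚ 40 ≤ x ^ℚ 21) →
                 PrimeNear[a/b]⁴⁰ a b
    scale-back (p , prime-p , p≤x , gap) = p , prime-p , below , above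
      where
      below : p ℕ.* b ℕ.^ 40 ℕ.≤ a ℕ.^ 40
      below = toℚ-cancel-≤
        (subst₂ _≤_ (sym (toℚ-* p (b ℕ.^ 40))) (tᵏ*bᵏ≡aᵏ 40) (*-monoʳ-≤-nonNeg β p≤x))
      rescale : (t ^ℚ 21 + toℚ p) * β ≡ toℚ (a ℕ.^ 21 ℕ.* b ℕ.^ 19 ℕ.+ p ℕ.* b ℕ.^ 40)
      rescale = begin
        (t ^ℚ 21 + toℚ p) * β                                ≡⟨ *-distribʳ-+ β (t ^ℚ 21) (toℚ p) ⟩
        t ^ℚ 21 * β + toℚ p * β                              ≡⟨ cong₂ _+_ t²¹*β≡a²¹b¹⁹ (sym (toℚ-* p (b ℕ.^ 40))) ⟩
        toℚ (a ℕ.^ 21 ℕ.* b ℕ.^ 19) + toℚ (p ℕ.* b ℕ.^ 40)   ≡⟨ toℚ-+ (a ℕ.^ 21 ℕ.* b ℕ.^ 19) (p ℕ.* b ℕ.^ 40) ⟨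
        toℚ (a ℕ.^ 21 ℕ.* b ℕ.^ 19 ℕ.+ p ℕ.* b ℕ.^ 40)      ∎
      above : a ℕ.^ 40 ℕ.≤ a ℕ.^ 21 ℕ.* b ℕ.^ 19 ℕ.+ p ℕ.* b ℕ.^ 40
      above = toℚ-cancel-≤
        (subst₂ _≤_ (tᵏ*bᵏ≡aᵏ 40) rescale (*-monoʳ-≤-nonNeg β (x≤t²¹+q (toℚ p) gap)))

open import Defs
open import Data.Nat using (ℕ; suc; _∸_; _^_; _*_; s≤s; z≤n) renaming (_<_ to _<ℕ_)
open import Data.Nat.Primality using (Prime)
open import Data.Product using (_×_; _,_; ∃-syntax)
open import Data.Rational using (ℚ; _-_; _≤_; _<_)
open import Data.Nat.Properties using (n≤1+n; ≤-pred)
open import Data.Rational.Properties using (<-≤-trans)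
open import Relation.Binary.PropositionalEquality using (subst; refl)
open PowerBounds using (root-approx; [4m+3]B≤4A⇒m*b⁴⁰≤a⁴⁰; prime-window-lower; prime-window-upper)
open RationalScaling using (toℚ-mono-≤; prime-near-[a/b]⁴⁰)

theorem13 : (x₀ : ℚ) →
    (∀ (x : ℚ) → x₀ < x →
      ∃[ p ] (Prime p × toℚ p ≤ x × (x - toℚ p) ^ℚ 40 ≤ x ^ℚ 21)) →
    (r P′ P : ℕ) → NthPrime r P′ → NthPrime (suc r) P →
    toℚ P′ ≤ x₀ → x₀ < toℚ P →
    (n : ℕ) → P <ℕ n →
    ∃[ p ] (Prime p × (n ∸ 1) ^ 40 <ℕ p ^ 19 × p ^ 19 <ℕ n ^ 40)
theorem13 _ _ _ _ .0 _ (() , _) _ _ 1 (s≤s z≤n)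
theorem13 x₀ gaps _ _ P _ _ _ x₀<P n@(suc (suc k)) P<n =
  let a , a-below , quarter-gap = root-approx k b (n≤1+n _)
      p , prime-p , p-below , p-above =
        prime-near-[a/b]⁴⁰ gaps a b (suc k) x₀<m ([4m+3]B≤4A⇒m*b⁴⁰≤a⁴⁰ k a b quarter-gap)
  in p , prime-p
       -- n ∸ 1 reduces to suc k, but converting under ^ 40 would unfold the power; subst avoids it.
       , subst (λ m → m ^ 40 <ℕ p ^ 19) {suc k} {n ∸ 1} refl (prime-window-lower k a b p quarter-gap p-above)
       , prime-window-upper n a b p a-below p-below
  where
  b : ℕ
  b = suc (4 * 19 * n ^ 18)
  x₀<m : x₀ < toℚ (suc k)
  x₀<m = <-≤-trans x₀<P (toℚ-mono-≤ (≤-pred P<n))
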